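{- The sequence $(m(n))_{n\ge1}$ is not holonomic.
   Context: For a positive integer $n$, $m(n)$ denotes the number of ordered factorizations of $n$ into factors larger than $1$, i.e. the number of finite sequences $(d_1,\dots,d_r)$, $r\ge 1$, of integers $d_i\ge 2$ with $d_1\cdots d_r=n$. A sequence $(f(n))_{n\ge1}$ is holonomic if there exist an integer $k\ge 0$ and polynomials $g_0,\dots,g_k$ with integer coefficients, not all zero, such that $g_k(n)f(n+k)+g_{k-1}(n)f(n+k-1)+\cdots+g_0(n)f(n)=0$ for all $n\ge1$. -}

module Defs where

open import Data.Nat using (ℕ; zero; suc; _+_; _∸_; _≤_)
open import Data.Nat.Properties using (_≟_)
open import Data.Integer as ℤ using (ℤ; +_)
open import Data.List using (List; []; _∷_; map; concatMap; filter; length; upTo; foldr)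
open import Data.Nat.ListAction using (product)
open import Data.Fin using (Fin; toℕ)
open import Data.Product using (Σ; ∃; _×_)
open import Relation.Binary.PropositionalEquality using (_≡_; _≢_)
open import Relation.Nullary using (¬_)

listsOfLength : List ℕ → ℕ → List (List ℕ)
listsOfLength L zero    = [] ∷ []
listsOfLength L (suc r) = concatMap (λ d → map (d ∷_) (listsOfLength L r)) L

-- Candidate sequences (d₁,…,d_r) for factorizations of n:
-- 1 ≤ r ≤ n and 2 ≤ d_i ≤ n (any ordered factorization of n into factors ≥ 2
-- has length r ≤ n and factors ≤ n).  Each list appears exactly once.
candidates : ℕ → List (List ℕ)
candidates n =
  concatMap (λ i → listsOfLength (map (λ j → 2 + j) (upTo (n ∸ 1))) (suc i)) (upTo n)

-- m(n): the number of ordered factorizations of n into factors larger than 1,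
-- i.e. the number of sequences (d₁,…,d_r), r ≥ 1, d_i ≥ 2, with d₁⋯d_r = n.
m : ℕ → ℕ
m n = length (filter (λ ds → product ds ≟ n) (candidates n))

-- Polynomials with integer coefficients, as coefficient lists (constant term first).
Poly : Set
Poly = List ℤ

eval : Poly → ℕ → ℤ
eval p x = foldr (λ c acc → c ℤ.+ (+ x) ℤ.* acc) (+ 0) p

IsZeroPoly : Poly → Set
IsZeroPoly []       = Data.Unit.⊤ where import Data.Unit
IsZeroPoly (c ∷ cs) = (c ≡ + 0) × IsZeroPoly cs

sumFin : (k : ℕ) → (Fin (suc k) → ℤ) → ℤ
sumFin k t = foldr ℤ._+_ (+ 0) (Data.List.tabulate t)
  where import Data.List

Holonomic : (ℕ → ℤ) → Set
Holonomic f =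
  Σ ℕ λ k → Σ (Fin (suc k) → Poly) λ g →
    (¬ ((i : Fin (suc k)) → IsZeroPoly (g i))) ×
    ((n : ℕ) → 1 ≤ n → sumFin k (λ i → eval (g i) n ℤ.* f (n + toℕ i)) ≡ + 0)

-- For n ≥ 2, m n = m′ n where m′ n = ∑_{d ∣ n, d > 1} m′ (n / d). Two 2-adic facts follow from this
-- recursion: if p ^ (e + 1) ∣ n for a prime p then 2 ^ e ∣ m n, and m n is odd for squarefree n.
-- Suppose ∑_{i ≤ k} g_i(n) m(n + i) = 0 for all n ≥ 1, and fix j, s and x₀ with x₀ + j odd. The Chinese
-- remainder theorem, together with a counting argument for squarefree values of arithmetic progressions,
-- yields n ≡ x₀ (mod 2 ^ s) such that each n + i with i ≠ j is divisible by the (s + 1)-th power of a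
-- prime while n + j is squarefree. The recurrence at n then gives 2 ^ s ∣ g_j(n) ≡ g_j(x₀) (mod 2 ^ s).
-- As s is arbitrary, g_j vanishes at infinitely many points, so it is the zero polynomial.

{-# OPTIONS --safe #-}
module Submission where

open import Defs using (listsOfLength; m; Poly; eval; IsZeroPoly; sumFin; Holonomic)

open import Data.Bool using (true; false)
open import Data.Empty using (⊥; ⊥-elim)
open import Data.Fin as Fin using (Fin; toℕ)
import Data.Fin.Properties as Fin
open import Data.Integer as ℤ using (ℤ)
import Data.Integer.Properties as ℤ
open import Data.Integer.Divisibility.Signed as ℤ∣ using (∣ᵤ⇒∣; ∣⇒∣ᵤ)
open import Data.Integer.Tactic.RingSolver using () renaming (solve-∀ to solve-ℤ)
open import Data.List using (List; []; _∷_; _++_; map; concatMap; filter; length; upTo; tabulate; foldr)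
open import Data.List.Properties using (filter-++; length-++; filter-≐; filter-none; map-∘; map-++; upTo-∷ʳ)
open import Data.List.Relation.Unary.All using (All; []; _∷_)
import Data.List.Relation.Unary.All as All
open import Data.Nat
open import Data.Nat.Coprimality using (Coprime; coprime-divisor; coprime-Bézout)
import Data.Nat.Coprimality as Coprimality
open import Data.Nat.DivMod
open import Data.Nat.Divisibility
open import Data.Nat.GCD using (module Bézout)
open import Data.Nat.Induction using (<-rec)
open import Data.Nat.ListAction using (sum; product)
open import Data.Nat.ListAction.Properties using (sum-++)
open import Data.Nat.Primality
open import Data.Nat.Primality.Factorisation using (factorise; PrimeFactorisation)
open import Data.Nat.Properties
open import Data.Nat.Tactic.RingSolver using (solve-∀)
open import Data.Product using (∃-syntax; _×_; _,_; proj₁; proj₂)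
open import Data.Sum using (_⊎_; inj₁; inj₂)
open import Data.Unit using (tt)
open import Function using (_∘_)
open import Relation.Binary.Definitions using (tri<; tri≈; tri>)
open import Relation.Binary.PropositionalEquality
  using (_≡_; _≢_; refl; sym; trans; cong; cong₂; subst; module ≡-Reasoning)
open import Relation.Nullary using (Dec; yes; no; does; ¬_; contradiction)
open import Relation.Unary using (Decidable)
open import Algebra.Properties.CommutativeSemigroup +-commutativeSemigroup using (interchange; x∙yz≈y∙xz)

∑< : ℕ → (ℕ → ℕ) → ℕ
∑< zero    f = 0
∑< (suc n) f = ∑< n f + f n

syntax ∑< n (λ i → e) = ∑[ i < n ] e

module _ {f g : ℕ → ℕ} where

  ∑-cong : ∀ n → (∀ i → i < n → f i ≡ g i) → ∑< n f ≡ ∑< n g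
  ∑-cong zero    eq = refl
  ∑-cong (suc n) eq = cong₂ _+_ (∑-cong n (λ i i<n → eq i (m<n⇒m<1+n i<n))) (eq n ≤-refl)

  ∑-mono-≤ : ∀ n → (∀ i → i < n → f i ≤ g i) → ∑< n f ≤ ∑< n g
  ∑-mono-≤ zero    le = z≤n
  ∑-mono-≤ (suc n) le = +-mono-≤ (∑-mono-≤ n (λ i i<n → le i (m<n⇒m<1+n i<n))) (le n ≤-refl)

  ∑-distrib-+ : ∀ n → ∑[ i < n ] (f i + g i) ≡ ∑< n f + ∑< n g
  ∑-distrib-+ zero    = refl
  ∑-distrib-+ (suc n) = trans (cong (_+ (f n + g n)) (∑-distrib-+ n)) (interchange (∑< n f) (∑< n g) (f n) (g n))

∑-zero : ∀ n {f : ℕ → ℕ} → (∀ i → i < n → f i ≡ 0) → ∑< n f ≡ 0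
∑-zero zero    eq = refl
∑-zero (suc n) eq = cong₂ _+_ (∑-zero n (λ i i<n → eq i (m<n⇒m<1+n i<n))) (eq n ≤-refl)

∑-const : ∀ n c → ∑[ i < n ] c ≡ n * c
∑-const zero    c = refl
∑-const (suc n) c = trans (cong (_+ c) (∑-const n c)) (+-comm (n * c) c)

∑-∣ : ∀ n {d} {f : ℕ → ℕ} → (∀ i → i < n → d ∣ f i) → d ∣ ∑< n f
∑-∣ zero    div = divides 0 refl
∑-∣ (suc n) div = ∣m∣n⇒∣m+n (∑-∣ n (λ i i<n → div i (m<n⇒m<1+n i<n))) (div n ≤-refl)

∑-shift : ∀ n (f : ℕ → ℕ) → ∑[ i < suc n ] f i ≡ f 0 + ∑[ i < n ] f (suc i)
∑-shift zero    f = +-comm 0 (f 0)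
∑-shift (suc n) f = trans (cong (_+ f (suc n)) (∑-shift n f)) (+-assoc (f 0) _ _)

∑-split : ∀ m n (f : ℕ → ℕ) → ∑[ i < m + n ] f i ≡ ∑< m f + ∑[ i < n ] f (m + i)
∑-split m zero    f = trans (cong (λ k → ∑< k f) (+-identityʳ m)) (sym (+-identityʳ _))
∑-split m (suc n) f = begin
  ∑< (m + suc n) f                                ≡⟨ cong (λ k → ∑< k f) (+-suc m n) ⟩
  ∑< (m + n) f + f (m + n)                        ≡⟨ cong (_+ f (m + n)) (∑-split m n f) ⟩
  ∑< m f + ∑[ i < n ] f (m + i) + f (m + n)       ≡⟨ +-assoc (∑< m f) _ _ ⟩
  ∑< m f + ∑[ i < suc n ] f (m + i)               ∎
  where open ≡-Reasoning

∑-extend : ∀ {m n} (f : ℕ → ℕ) → m ≤ n → (∀ i → m ≤ i → f i ≡ 0) → ∑< n f ≡ ∑< m f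
∑-extend {m} {n} f m≤n vanish = begin
  ∑< n f                                   ≡⟨ cong (λ k → ∑< k f) (m+[n∸m]≡n m≤n) ⟨
  ∑< (m + (n ∸ m)) f                       ≡⟨ ∑-split m (n ∸ m) f ⟩
  ∑< m f + ∑[ i < n ∸ m ] f (m + i)
    ≡⟨ cong (∑< m f +_) (∑-zero (n ∸ m) (λ i _ → vanish (m + i) (m≤m+n m i))) ⟩
  ∑< m f + 0                               ≡⟨ +-identityʳ _ ⟩
  ∑< m f                                   ∎
  where open ≡-Reasoning

∑-swap : ∀ m n (f : ℕ → ℕ → ℕ) → ∑[ i < m ] ∑[ j < n ] f i j ≡ ∑[ j < n ] ∑[ i < m ] f i j
∑-swap zero    n f = sym (∑-zero n (λ _ _ → refl))
∑-swap (suc m) n f = trans (cong (_+ ∑[ j < n ] f m j) (∑-swap m n f)) (sym (∑-distrib-+ n))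

when : {P : Set} → Dec P → ℕ → ℕ
when (yes _) v = v
when (no _)  _ = 0

unless : {P : Set} → Dec P → ℕ → ℕ
unless (yes _) _ = 0
unless (no _)  v = v

𝟙 : {P : Set} → Dec P → ℕ
𝟙 D = when D 1

when-cong : ∀ {P Q : Set} (P? : Dec P) (Q? : Dec Q) {v w} →
            (P → Q) → (Q → P) → (P → v ≡ w) → when P? v ≡ when Q? w
when-cong (yes p) (yes q) _   _   v≡w = v≡w p
when-cong (yes p) (no ¬q) p→q _   _   = ⊥-elim (¬q (p→q p))
when-cong (no ¬p) (yes q) _   q→p _   = ⊥-elim (¬p (q→p q))
when-cong (no _)  (no _)  _   _   _   = refl

when+unless : ∀ {P : Set} (P? : Dec P) v → when P? v + unless P? v ≡ v
when+unless (yes _) v = +-identityʳ v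
when+unless (no _)  v = refl

∑-when : ∀ n {P : Set} (P? : Dec P) (f : ℕ → ℕ) → ∑[ i < n ] when P? (f i) ≡ when P? (∑< n f)
∑-when n (yes _) f = refl
∑-when n (no _)  f = ∑-zero n (λ _ _ → refl)

∑-when+unless : ∀ n {P : ℕ → Set} (P? : ∀ i → Dec (P i)) (f : ℕ → ℕ) →
                ∑[ i < n ] when (P? i) (f i) + ∑[ i < n ] unless (P? i) (f i) ≡ ∑< n f
∑-when+unless n P? f = trans (sym (∑-distrib-+ n)) (∑-cong n (λ i _ → when+unless (P? i) (f i)))

term≤∑ : ∀ n (f : ℕ → ℕ) {i} → i < n → f i ≤ ∑< n f
term≤∑ (suc n) f i<1+n with m<1+n⇒m<n∨m≡n i<1+n
... | inj₁ i<n  = ≤-trans (term≤∑ n f i<n) (m≤m+n (∑< n f) (f n))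
... | inj₂ refl = m≤n+m (f n) (∑< n f)

∑<-pigeonhole : ∀ X (h : ℕ → ℕ) → ∑< X h < X → ∃[ t ] t < X × h t ≡ 0
∑<-pigeonhole (suc X) h ∑<X with h X ≟ 0
... | yes hX≡0 = X , ≤-refl , hX≡0
... | no hX≢0  with ∑<-pigeonhole X h ∑<′X
  where
  ∑<′X : ∑< X h < X
  ∑<′X = ≤-trans (subst (_≤ ∑< X h + h X) (+-comm (∑< X h) 1) (+-monoʳ-≤ (∑< X h) (n≢0⇒n>0 hX≢0)))
                 (≤-pred ∑<X)
...   | t , t<X , ht≡0 = t , m<n⇒m<1+n t<X , ht≡0

-- Division with the junk value n ÷ 0 = 0, so that n ÷ d can be summed over the divisors d of n.
_÷_ : ℕ → ℕ → ℕ
n ÷ zero  = 0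
n ÷ suc d = n / suc d

÷≡/ : ∀ n d .{{_ : NonZero d}} → n ÷ d ≡ n / d
÷≡/ n (suc d) = refl

divisorSum : ℕ → (ℕ → ℕ) → ℕ
divisorSum n f = ∑[ k < n ] when (suc k ∣? n) (f (suc k))

syntax divisorSum n (λ d → e) = ∑[ d ∣ n ] e

-- ∑[ d ∣ n ∖ p ] ranges over the divisors d of n that are not multiples of p.
divisorSum∖ : ℕ → ℕ → (ℕ → ℕ) → ℕ
divisorSum∖ p n f = ∑[ k < n ] unless (p ∣? suc k) (when (suc k ∣? n) (f (suc k)))

syntax divisorSum∖ p n (λ d → e) = ∑[ d ∣ n ∖ p ] e

divisorSum-1+ : ∀ n .{{_ : NonZero n}} (f : ℕ → ℕ) →
                ∑[ d ∣ n ] f d ≡ f 1 + ∑[ j < n ∸ 1 ] when (2 + j ∣? n) (f (2 + j))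
divisorSum-1+ n@(suc n₀) f = trans (∑-shift n₀ _) (cong₂ _+_ (when-1∣ (1 ∣? n)) refl)
  where
  when-1∣ : (1∣n? : Dec (1 ∣ n)) → when 1∣n? (f 1) ≡ f 1
  when-1∣ (yes _)  = refl
  when-1∣ (no 1∤n) = ⊥-elim (1∤n (1∣ n))

divisorSum∖-1+ : ∀ {p} n .{{_ : NonZero n}} (f : ℕ → ℕ) → 1 < p →
                 ∑[ d ∣ n ∖ p ] f d ≡ f 1 + ∑[ j < n ∸ 1 ] unless (p ∣? 2 + j) (when (2 + j ∣? n) (f (2 + j)))
divisorSum∖-1+ {p} n@(suc n₀) f 1<p = trans (∑-shift n₀ _) (cong₂ _+_ (unless-p∣1 (p ∣? 1) (1 ∣? n)) refl)
  where
  unless-p∣1 : (p∣1? : Dec (p ∣ 1)) (1∣n? : Dec (1 ∣ n)) → unless p∣1? (when 1∣n? (f 1)) ≡ f 1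
  unless-p∣1 (yes p∣1) _        = ⊥-elim (<⇒≱ 1<p (∣⇒≤ p∣1))
  unless-p∣1 (no _)    (yes _)  = refl
  unless-p∣1 (no _)    (no 1∤n) = ⊥-elim (1∤n (1∣ n))

module _ (p′ : ℕ) (F : ℕ → ℕ) where

  private
    p = suc p′

  -- Of the p consecutive numbers p * M + 1, …, p * M + p only the last is a multiple of p.
  ∑-multiples-block : ∀ M → ∑[ u < p ] when (p ∣? suc (p * M + u)) (F (suc (p * M + u))) ≡ F (p * suc M)
  ∑-multiples-block M = cong₂ _+_ (∑-zero p′ below) (last (p ∣? suc (p * M + p′)))
    where
    p*M+p≡p*[1+M] : suc (p * M + p′) ≡ p * suc M
    p*M+p≡p*[1+M] = trans (sym (+-suc (p * M) p′)) (trans (+-comm (p * M) p) (sym (*-suc p M)))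
    below : ∀ u → u < p′ → when (p ∣? suc (p * M + u)) (F (suc (p * M + u))) ≡ 0
    below u u<p′ with p ∣? suc (p * M + u)
    ... | no _    = refl
    ... | yes p∣  = ⊥-elim (<⇒≱ (s≤s u<p′) (∣⇒≤ p∣1+u))
      where
      p∣1+u : p ∣ suc u
      p∣1+u = ∣m+n∣m⇒∣n (subst (p ∣_) (sym (+-suc (p * M) u)) p∣) (m∣m*n M)
    last : (p∣? : Dec (p ∣ suc (p * M + p′))) → when p∣? (F (suc (p * M + p′))) ≡ F (p * suc M)
    last (yes _)  = cong F p*M+p≡p*[1+M]
    last (no p∤)  = ⊥-elim (p∤ (subst (p ∣_) (sym p*M+p≡p*[1+M]) (m∣m*n (suc M))))

  ∑-multiples : ∀ n → ∑[ k < p * n ] when (p ∣? suc k) (F (suc k)) ≡ ∑[ e < n ] F (p * suc e)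
  ∑-multiples zero    = cong (λ k → ∑[ i < k ] when (p ∣? suc i) (F (suc i))) (*-zeroʳ p)
  ∑-multiples (suc n) = begin
    ∑< (p * suc n) g                         ≡⟨ cong (λ k → ∑< k g) (trans (*-suc p n) (+-comm p (p * n))) ⟩
    ∑< (p * n + p) g                         ≡⟨ ∑-split (p * n) p g ⟩
    ∑< (p * n) g + ∑[ u < p ] g (p * n + u)  ≡⟨ cong₂ _+_ (∑-multiples n) (∑-multiples-block n) ⟩
    ∑[ e < suc n ] F (p * suc e)             ∎
    where
    open ≡-Reasoning
    g : ℕ → ℕ
    g k = when (p ∣? suc k) (F (suc k))

divisorSum-split : ∀ {p} .{{_ : NonZero p}} n (f : ℕ → ℕ) →
                   ∑[ d ∣ p * n ] f d ≡ ∑[ e ∣ n ] f (p * e) + ∑[ d ∣ p * n ∖ p ] f d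
divisorSum-split {p@(suc p′)} n f = begin
  ∑[ d ∣ p * n ] f d
    ≡⟨ ∑-when+unless (p * n) (λ k → p ∣? suc k) (λ k → when (suc k ∣? p * n) (f (suc k))) ⟨
  ∑[ k < p * n ] when (p ∣? suc k) (when (suc k ∣? p * n) (f (suc k))) + rest
    ≡⟨ cong (_+ rest) (∑-multiples p′ (λ d → when (d ∣? p * n) (f d)) n) ⟩
  ∑[ e < n ] when (p * suc e ∣? p * n) (f (p * suc e)) + rest
    ≡⟨ cong (_+ rest) (∑-cong n (λ e _ → when-cong (p * suc e ∣? p * n) (suc e ∣? n)
                                                 (*-cancelˡ-∣ p) (*-monoʳ-∣ p) (λ _ → refl))) ⟩
  ∑[ e ∣ n ] f (p * e) + rest
    ∎
  where
  open ≡-Reasoning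
  rest = ∑[ d ∣ p * n ∖ p ] f d

prime⇒>1 : ∀ {p} → Prime p → 1 < p
prime⇒>1 {p} pr = nonTrivial⇒n>1 p {{prime⇒nonTrivial pr}}

∃prime∣ : ∀ {n} → 1 < n → ∃[ p ] Prime p × p ∣ n
∃prime∣ {n} 1<n = first-factor (factors fac) (isFactorisation fac) (factorsPrime fac)
  where
  open PrimeFactorisation
  fac = factorise n {{>-nonZero (<-trans z<s 1<n)}}
  first-factor : ∀ ps → n ≡ product ps → All Prime ps → ∃[ p ] Prime p × p ∣ n
  first-factor []       n≡1 _         = ⊥-elim (<⇒≢ 1<n (sym n≡1))
  first-factor (p ∷ ps) n≡p*_ (pr ∷ _) = p , pr , divides (product ps) (trans n≡p*_ (*-comm p _))

prime∤⇒coprime : ∀ {p m} → Prime p → ¬ p ∣ m → Coprime m p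
prime∤⇒coprime pr p∤m (d∣m , d∣p) with prime⇒irreducible pr d∣p
... | inj₁ d≡1 = d≡1
... | inj₂ refl = ⊥-elim (p∤m d∣m)

no-common-prime⇒coprime : ∀ {m n} → (∀ {r} → Prime r → r ∣ m → r ∣ n → ⊥) → Coprime m n
no-common-prime⇒coprime {m} {n} none {zero} (0∣m , 0∣n)
  rewrite 0∣⇒≡0 0∣m | 0∣⇒≡0 0∣n = ⊥-elim (none prime[2] (2 ∣0) (2 ∣0))
no-common-prime⇒coprime none {suc zero}    _           = refl
no-common-prime⇒coprime none {suc (suc d)} (d∣m , d∣n) with ∃prime∣ {suc (suc d)} (s<s z<s)
... | r , pr , r∣d = ⊥-elim (none pr (∣-trans r∣d d∣m) (∣-trans r∣d d∣n))

prime∣^⇒∣ : ∀ {r b} → Prime r → ∀ e → r ∣ b ^ e → r ∣ b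
prime∣^⇒∣ pr zero    r∣1 = ⊥-elim (<⇒≱ (prime⇒>1 pr) (∣⇒≤ r∣1))
prime∣^⇒∣ pr (suc e) r∣b^e with euclidsLemma _ _ pr r∣b^e
... | inj₁ r∣b   = r∣b
... | inj₂ r∣b^e = prime∣^⇒∣ pr e r∣b^e

prime∣prime⇒≡ : ∀ {r p} → Prime r → Prime p → r ∣ p → r ≡ p
prime∣prime⇒≡ pr pp r∣p with prime⇒irreducible pp r∣p
... | inj₁ refl = ⊥-elim (<⇒≢ (prime⇒>1 pr) refl)
... | inj₂ r≡p  = r≡p

prime^-coprime : ∀ {p m} → Prime p → ¬ p ∣ m → ∀ e → Coprime (p ^ e) m
prime^-coprime pp p∤m e = no-common-prime⇒coprime λ pr r∣p^e r∣m →
  p∤m (subst (_∣ _) (prime∣prime⇒≡ pr pp (prime∣^⇒∣ pr e r∣p^e)) r∣m)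

coprime-∣ˡ : ∀ {a b c} → Coprime a b → c ∣ a → Coprime c b
coprime-∣ˡ a⊥b c∣a (e∣c , e∣b) = a⊥b (∣-trans e∣c c∣a , e∣b)

coprime-*ʳ : ∀ {a b c} → Coprime a b → Coprime a c → Coprime a (b * c)
coprime-*ʳ a⊥b a⊥c (e∣a , e∣bc) = a⊥c (e∣a , coprime-divisor (coprime-∣ˡ a⊥b e∣a) e∣bc)

coprime-+* : ∀ {a M} t → Coprime a M → Coprime (a + M * t) M
coprime-+* {a} {M} t a⊥M {e} (e∣a+Mt , e∣M) =
  a⊥M (∣m+n∣m⇒∣n (subst (e ∣_) (+-comm a (M * t)) e∣a+Mt) (∣-trans e∣M (m∣m*n t)) , e∣M)

divisorSum∖-coprime : ∀ {p n} (f : ℕ → ℕ) → Prime p → ¬ p ∣ n → ∑[ d ∣ p * n ∖ p ] f d ≡ ∑[ d ∣ n ] f d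
divisorSum∖-coprime {p} {n} f pp p∤n = begin
  ∑[ d ∣ p * n ∖ p ] f d                      ≡⟨ ∑-cong (p * n) (λ k _ → termwise k (p ∣? suc k)) ⟩
  ∑[ k < p * n ] when (suc k ∣? n) (f (suc k)) ≡⟨ ∑-extend _ n≤p*n beyond ⟩
  ∑[ d ∣ n ] f d                               ∎
  where
  open ≡-Reasoning
  instance _ = prime⇒nonZero pp
  n≢0 : NonZero n
  n≢0 = ≢-nonZero λ { refl → p∤n (p ∣0) }
  n≤p*n : n ≤ p * n
  n≤p*n = m≤n*m n p
  termwise : ∀ k (p∣? : Dec (p ∣ suc k)) →
             unless p∣? (when (suc k ∣? p * n) (f (suc k))) ≡ when (suc k ∣? n) (f (suc k))
  termwise k (yes p∣) with suc k ∣? n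
  ... | yes k∣n = ⊥-elim (p∤n (∣-trans p∣ k∣n))
  ... | no _    = refl
  termwise k (no p∤) = when-cong (suc k ∣? p * n) (suc k ∣? n)
    (coprime-divisor (prime∤⇒coprime pp p∤)) (∣n⇒∣m*n p) (λ _ → refl)
  beyond : ∀ k → n ≤ k → when (suc k ∣? n) (f (suc k)) ≡ 0
  beyond k n≤k with suc k ∣? n
  ... | yes k∣n = ⊥-elim (>⇒∤ {{n≢0}} (s≤s n≤k) k∣n)
  ... | no _    = refl

-- Counting ordered factorisations

module _ {A : Set} {P : A → Set} (P? : Decidable P) where

  length-filter-[_] : ∀ x → length (filter P? (x ∷ [])) ≡ 𝟙 (P? x)
  length-filter-[ x ] with P? x
  ... | yes _ = refl
  ... | no _  = refl

  length-filter-map : ∀ {B : Set} (g : B → A) xs → length (filter P? (map g xs)) ≡ length (filter (P? ∘ g) xs)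
  length-filter-map g []       = refl
  length-filter-map g (x ∷ xs) with does (P? (g x))
  ... | true  = cong suc (length-filter-map g xs)
  ... | false = length-filter-map g xs

  length-filter-concatMap : ∀ {B : Set} (f : B → List A) xs →
                            length (filter P? (concatMap f xs)) ≡ sum (map (λ x → length (filter P? (f x))) xs)
  length-filter-concatMap f []       = refl
  length-filter-concatMap f (x ∷ xs) = begin
    length (filter P? (f x ++ concatMap f xs))                ≡⟨ cong length (filter-++ P? (f x) _) ⟩
    length (filter P? (f x) ++ filter P? (concatMap f xs))    ≡⟨ length-++ (filter P? (f x)) ⟩
    length (filter P? (f x)) + length (filter P? (concatMap f xs))
      ≡⟨ cong (length (filter P? (f x)) +_) (length-filter-concatMap f xs) ⟩
    sum (map (λ x → length (filter P? (f x))) (x ∷ xs))        ∎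
    where open ≡-Reasoning

sum-map-upTo : ∀ n (f : ℕ → ℕ) → sum (map f (upTo n)) ≡ ∑< n f
sum-map-upTo zero    f = refl
sum-map-upTo (suc n) f = begin
  sum (map f (upTo (suc n)))           ≡⟨ cong (sum ∘ map f) (upTo-∷ʳ n) ⟨
  sum (map f (upTo n ++ n ∷ []))       ≡⟨ cong sum (map-++ f (upTo n) _) ⟩
  sum (map f (upTo n) ++ f n ∷ [])     ≡⟨ sum-++ (map f (upTo n)) _ ⟩
  sum (map f (upTo n)) + (f n + 0)     ≡⟨ cong₂ _+_ (sum-map-upTo n f) (+-identityʳ (f n)) ⟩
  ∑< (suc n) f                         ∎
  where open ≡-Reasoning

factorisations : ℕ → ℕ → ℕ
factorisations zero    x = 𝟙 (1 ≟ x)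
factorisations (suc r) x = ∑[ j < x ∸ 1 ] when (2 + j ∣? x) (factorisations r (x / (2 + j)))

-- Unlike m, m′ counts the empty factorisation of 1: m′ 1 = 1 but m 1 = 0.
m′ : ℕ → ℕ
m′ x = ∑[ r < suc x ] factorisations r x

factorisations-vanish : ∀ {r x} → x < r → factorisations r x ≡ 0
factorisations-vanish {suc r} {zero}  _         = refl
factorisations-vanish {suc r} {suc x} (s≤s x≤r) = ∑-zero x term
  where
  term : ∀ j → j < x → when (2 + j ∣? suc x) (factorisations r (suc x / (2 + j))) ≡ 0
  term j _ with 2 + j ∣? suc x
  ... | yes _ = factorisations-vanish (<-≤-trans (m/n<m (suc x) (2 + j) (s≤s (s≤s z≤n))) x≤r)
  ... | no _  = refl

factorRange : ℕ → List ℕ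
factorRange b = map (2 +_) (upTo b)

productCount : List ℕ → ℕ → ℕ → ℕ
productCount L r x = length (filter (λ ds → product ds ≟ x) (listsOfLength L r))

length-filter-multiple : ∀ d {x} .{{_ : NonZero d}} (xss : List (List ℕ)) →
  length (filter (λ ds → d * product ds ≟ x) xss) ≡ when (d ∣? x) (length (filter (λ ds → product ds ≟ x / d) xss))
length-filter-multiple d {x} xss with d ∣? x
... | yes d∣x = cong length (filter-≐ _ _ ((λ {ds} → to {ds}) , (λ {ds} → from {ds})) xss)
  where
  to : ∀ {ds} → d * product ds ≡ x → product ds ≡ x / d
  to {ds} eq = trans (sym (m*n/n≡m (product ds) d)) (cong (_/ d) (trans (*-comm (product ds) d) eq))
  from : ∀ {ds} → product ds ≡ x / d → d * product ds ≡ x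
  from eq = trans (cong (d *_) eq) (m*[n/m]≡n d∣x)
... | no d∤x = cong length (filter-none _ (All.universal d∤ xss))
  where
  d∤ : ∀ ds → ¬ d * product ds ≡ x
  d∤ ds eq = d∤x (divides (product ds) (trans (sym eq) (*-comm d _)))

productCount-suc : ∀ b r x → productCount (factorRange b) (suc r) x ≡
                   ∑[ j < b ] when (2 + j ∣? x) (productCount (factorRange b) r (x / (2 + j)))
productCount-suc b r x = begin
  length (filter P? (concatMap (λ d → map (d ∷_) xss) (factorRange b)))
    ≡⟨ length-filter-concatMap P? (λ d → map (d ∷_) xss) (factorRange b) ⟩
  sum (map (λ d → length (filter P? (map (d ∷_) xss))) (map (2 +_) (upTo b)))
    ≡⟨ cong sum (map-∘ (upTo b)) ⟨
  sum (map (λ j → length (filter P? (map ((2 + j) ∷_) xss))) (upTo b))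
    ≡⟨ sum-map-upTo b _ ⟩
  ∑[ j < b ] length (filter P? (map ((2 + j) ∷_) xss))
    ≡⟨ ∑-cong b (λ j _ → trans (length-filter-map P? ((2 + j) ∷_) xss) (length-filter-multiple (2 + j) xss)) ⟩
  ∑[ j < b ] when (2 + j ∣? x) (productCount (factorRange b) r (x / (2 + j)))
    ∎
  where
  open ≡-Reasoning
  xss = listsOfLength (factorRange b) r
  P? = λ ds → product ds ≟ x

productCount≡factorisations : ∀ {b} r x → 0 < x → x ∸ 1 ≤ b → productCount (factorRange b) r x ≡ factorisations r x
productCount≡factorisations zero x _ _ = length-filter-[ (λ ds → product ds ≟ x) ] []
productCount≡factorisations {b} (suc r) x 0<x x∸1≤b = begin
  productCount (factorRange b) (suc r) x
    ≡⟨ productCount-suc b r x ⟩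
  ∑[ j < b ] when (2 + j ∣? x) (productCount (factorRange b) r (x / (2 + j)))
    ≡⟨ ∑-cong b (λ j _ → termwise j) ⟩
  ∑[ j < b ] when (2 + j ∣? x) (factorisations r (x / (2 + j)))
    ≡⟨ ∑-extend _ x∸1≤b beyond ⟩
  factorisations (suc r) x
    ∎
  where
  open ≡-Reasoning
  termwise : ∀ j → when (2 + j ∣? x) (productCount (factorRange b) r (x / (2 + j)))
                 ≡ when (2 + j ∣? x) (factorisations r (x / (2 + j)))
  termwise j with 2 + j ∣? x
  ... | no _    = refl
  ... | yes d∣x = productCount≡factorisations r (x / (2 + j)) (m≥n⇒m/n>0 (∣⇒≤ {{>-nonZero 0<x}} d∣x))
                    (≤-trans (∸-monoˡ-≤ 1 (m/n≤m x (2 + j))) x∸1≤b)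
  beyond : ∀ j → x ∸ 1 ≤ j → when (2 + j ∣? x) (factorisations r (x / (2 + j))) ≡ 0
  beyond j x∸1≤j with 2 + j ∣? x
  ... | no _    = refl
  ... | yes d∣x = ⊥-elim (>⇒∤ {{>-nonZero 0<x}} (s≤s (≤-trans (m≤n+m∸n x 1) (s≤s x∸1≤j))) d∣x)

m≡∑factorisations : ∀ {n} → 0 < n → m n ≡ ∑[ i < n ] factorisations (suc i) n
m≡∑factorisations {n} 0<n = begin
  m n
    ≡⟨ length-filter-concatMap P? (λ i → listsOfLength (factorRange (n ∸ 1)) (suc i)) (upTo n) ⟩
  sum (map (λ i → productCount (factorRange (n ∸ 1)) (suc i) n) (upTo n))
    ≡⟨ sum-map-upTo n _ ⟩
  ∑[ i < n ] productCount (factorRange (n ∸ 1)) (suc i) n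
    ≡⟨ ∑-cong n (λ i _ → productCount≡factorisations (suc i) n 0<n ≤-refl) ⟩
  ∑[ i < n ] factorisations (suc i) n
    ∎
  where
  open ≡-Reasoning
  P? = λ ds → product ds ≟ n

m′≡∑factorisations : ∀ {n} → 1 < n → m′ n ≡ ∑[ i < n ] factorisations (suc i) n
m′≡∑factorisations {n} 1<n = trans (∑-shift n (λ r → factorisations r n)) (cong₂ _+_ (no-empty (1 ≟ n)) refl)
  where
  no-empty : (1≟n : Dec (1 ≡ n)) → 𝟙 1≟n ≡ 0
  no-empty (yes 1≡n) = ⊥-elim (<⇒≢ 1<n 1≡n)
  no-empty (no _)    = refl

m≡m′ : ∀ {n} → 1 < n → m n ≡ m′ n
m≡m′ 1<n = trans (m≡∑factorisations (<-trans z<s 1<n)) (sym (m′≡∑factorisations 1<n))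

m′-rec : ∀ {n} → 1 < n → m′ n ≡ ∑[ j < n ∸ 1 ] when (2 + j ∣? n) (m′ (n / (2 + j)))
m′-rec {n} 1<n = begin
  m′ n
    ≡⟨ m′≡∑factorisations 1<n ⟩
  ∑[ i < n ] ∑[ j < n ∸ 1 ] when (2 + j ∣? n) (factorisations i (n / (2 + j)))
    ≡⟨ ∑-swap n (n ∸ 1) _ ⟩
  ∑[ j < n ∸ 1 ] ∑[ i < n ] when (2 + j ∣? n) (factorisations i (n / (2 + j)))
    ≡⟨ ∑-cong (n ∸ 1) (λ j _ → trans (∑-when n (2 + j ∣? n) _) (cong (when (2 + j ∣? n)) (truncate j))) ⟩
  ∑[ j < n ∸ 1 ] when (2 + j ∣? n) (m′ (n / (2 + j)))
    ∎
  where
  open ≡-Reasoning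
  instance _ = >-nonZero (<-trans z<s 1<n)
  truncate : ∀ j → ∑[ i < n ] factorisations i (n / (2 + j)) ≡ m′ (n / (2 + j))
  truncate j = ∑-extend _ (m/n<m n (2 + j) (s≤s (s≤s z≤n))) (λ i → factorisations-vanish)

divisorSum-m′ : ∀ {n} → 1 < n → ∑[ d ∣ n ] m′ (n ÷ d) ≡ m′ n + m′ n
divisorSum-m′ {n@(suc _)} 1<n =
  trans (divisorSum-1+ n (λ d → m′ (n ÷ d))) (cong₂ _+_ (cong m′ (n/1≡n n)) (sym (m′-rec 1<n)))

-- 2-adic properties of m′

m′-split : ∀ {p n′} → Prime p → 1 < n′ →
  m′ (p * n′) ≡ m′ n′ + m′ n′ +
                ∑[ j < p * n′ ∸ 1 ] unless (p ∣? 2 + j) (when (2 + j ∣? p * n′) (m′ (p * n′ / (2 + j))))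
m′-split {p} {n′} pp 1<n′ = +-cancelˡ-≡ (m′ n) _ _ (begin
  m′ n + m′ n                                        ≡⟨ divisorSum-m′ 1<n ⟨
  ∑[ d ∣ n ] m′ (n ÷ d)                              ≡⟨ divisorSum-split n′ (λ d → m′ (n ÷ d)) ⟩
  ∑[ e ∣ n′ ] m′ (n ÷ (p * e)) + ∑[ d ∣ n ∖ p ] m′ (n ÷ d)
    ≡⟨ cong₂ _+_ (trans (∑-cong n′ (λ e _ → cong (when (suc e ∣? n′)) (cancel e))) (divisorSum-m′ 1<n′))
                 (trans (divisorSum∖-1+ n (λ d → m′ (n ÷ d)) (prime⇒>1 pp)) (cong (_+ rest) (cong m′ (n/1≡n n)))) ⟩
  m′ n′ + m′ n′ + (m′ n + rest)                      ≡⟨ x∙yz≈y∙xz (m′ n′ + m′ n′) (m′ n) rest ⟩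
  m′ n + (m′ n′ + m′ n′ + rest)                      ∎)
  where
  open ≡-Reasoning
  n = p * n′
  instance
    _ = prime⇒nonZero pp
    _ = >-nonZero (<-trans z<s 1<n′)
    _ = m*n≢0 p n′
  rest = ∑[ j < n ∸ 1 ] unless (p ∣? 2 + j) (when (2 + j ∣? n) (m′ (n / (2 + j))))
  1<n : 1 < n
  1<n = <-≤-trans 1<n′ (m≤n*m n′ p)
  cancel : ∀ e → m′ (n ÷ (p * suc e)) ≡ m′ (n′ ÷ suc e)
  cancel e = cong m′ (trans (÷≡/ n (p * suc e) {{m*n≢0 p (suc e)}}) (m*n/m*o≡n/o p n′ (suc e) {{_}} {{m*n≢0 p (suc e)}}))

-- In m′-split the term 2 m′ (n / p) gains the factor 2 that the exponent of p loses, while in every other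
-- summand m′ (n / d) the prime p does not divide d, so p ^ suc e still divides n / d.
prime^∣⇒2^∣m′ : ∀ {p} → Prime p → ∀ e n → p ^ suc e ∣ n → 2 ^ e ∣ m′ n
prime^∣⇒2^∣m′ {p} pp e n = <-rec (λ n → ∀ e → p ^ suc e ∣ n → 2 ^ e ∣ m′ n) step n e
  where
  instance _ = prime⇒nonZero pp
  step : ∀ n → (∀ {y} → y < n → ∀ e → p ^ suc e ∣ y → 2 ^ e ∣ m′ y) →
         ∀ e → p ^ suc e ∣ n → 2 ^ e ∣ m′ n
  step n       rec zero    _ = 1∣ m′ n
  step zero    rec (suc e) _ = (2 ^ suc e) ∣0
  step n@(suc _) rec (suc e) p^e+2∣n =
    subst (λ k → 2 ^ suc e ∣ m′ k) p*n′≡n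
          (subst (2 ^ suc e ∣_) (sym (m′-split pp 1<n′)) (∣m∣n⇒∣m+n twice rest))
    where
    p∣n : p ∣ n
    p∣n = m*n∣⇒m∣ p (p ^ suc e) p^e+2∣n
    n′ = n / p
    p*n′≡n : p * n′ ≡ n
    p*n′≡n = m*[n/m]≡n p∣n
    p^e+1∣n′ : p ^ suc e ∣ n′
    p^e+1∣n′ = *-cancelˡ-∣ p (subst (p ^ suc (suc e) ∣_) (sym p*n′≡n) p^e+2∣n)
    n′<n : n′ < n
    n′<n = m/n<m n p (prime⇒>1 pp)
    1<n′ : 1 < n′
    1<n′ = <-≤-trans (prime⇒>1 pp) (≤-trans (m≤m*n p (p ^ e) {{m^n≢0 p e}})
                                           (∣⇒≤ {{>-nonZero (m≥n⇒m/n>0 (∣⇒≤ p∣n))}} p^e+1∣n′))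
    twice : 2 ^ suc e ∣ m′ n′ + m′ n′
    twice = subst (2 ^ suc e ∣_) (cong (m′ n′ +_) (+-identityʳ (m′ n′))) (*-monoʳ-∣ 2 (rec n′<n e p^e+1∣n′))
    term : ∀ j → j < n ∸ 1 → 2 ^ suc e ∣ unless (p ∣? 2 + j) (when (2 + j ∣? n) (m′ (n / (2 + j))))
    term j _ with p ∣? 2 + j | 2 + j ∣? n
    ... | yes _  | _       = _ ∣0
    ... | no _   | no _    = _ ∣0
    ... | no p∤d | yes d∣n = rec (m/n<m n (2 + j) (s≤s (s≤s z≤n))) (suc e)
          (coprime-divisor (prime^-coprime pp p∤d (suc (suc e))) (subst (p ^ suc (suc e) ∣_) (sym (m*[n/m]≡n d∣n)) p^e+2∣n))
    rest = subst (λ k → 2 ^ suc e ∣ ∑[ j < k ∸ 1 ] unless (p ∣? 2 + j) (when (2 + j ∣? k) (m′ (k / (2 + j)))))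
                 (sym p*n′≡n) (∑-∣ (n ∸ 1) term)

SquareFree : ℕ → Set
SquareFree n = ∀ d → 1 < d → ¬ d * d ∣ n

τ : ℕ → ℕ
τ n = ∑[ d ∣ n ] 1

τ-even : ∀ {n} → SquareFree n → 1 < n → 2 ∣ τ n
τ-even {n} sf 1<n with ∃prime∣ 1<n
... | p , pp , p∣n = subst (λ k → 2 ∣ τ k) p*n′≡n (divides (τ n′) (begin
  τ (p * n′)                               ≡⟨ divisorSum-split n′ (λ _ → 1) ⟩
  τ n′ + ∑[ d ∣ p * n′ ∖ p ] 1             ≡⟨ cong (τ n′ +_) (divisorSum∖-coprime (λ _ → 1) pp p∤n′) ⟩
  τ n′ + τ n′                              ≡⟨ cong (τ n′ +_) (+-identityʳ (τ n′)) ⟨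
  2 * τ n′                                 ≡⟨ *-comm 2 (τ n′) ⟩
  τ n′ * 2                                 ∎))
  where
  open ≡-Reasoning
  instance _ = prime⇒nonZero pp
  n′ = n / p
  p*n′≡n : p * n′ ≡ n
  p*n′≡n = m*[n/m]≡n p∣n
  p∤n′ : ¬ p ∣ n′
  p∤n′ p∣n′ = sf p (prime⇒>1 pp) (subst (p * p ∣_) p*n′≡n (*-monoʳ-∣ p p∣n′))

odd⇒2∣1+ : ∀ {x} → ¬ 2 ∣ x → 2 ∣ 1 + x
odd⇒2∣1+ {zero}        2∤x = ⊥-elim (2∤x (2 ∣0))
odd⇒2∣1+ {suc zero}    _   = ∣-refl
odd⇒2∣1+ {suc (suc x)} 2∤2+x = ∣m∣n⇒∣m+n (∣-refl {2}) (odd⇒2∣1+ (2∤2+x ∘ ∣m∣n⇒∣m+n (∣-refl {2})))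

-- By induction every summand of m′-rec is odd, so m′ n ≡ τ n - 1 (mod 2), and τ n is even.
squareFree⇒m′-odd : ∀ {n} → SquareFree n → 0 < n → ¬ 2 ∣ m′ n
squareFree⇒m′-odd {n} = <-rec (λ n → SquareFree n → 0 < n → ¬ 2 ∣ m′ n) step n
  where
  step : ∀ n → (∀ {y} → y < n → SquareFree y → 0 < y → ¬ 2 ∣ m′ y) → SquareFree n → 0 < n → ¬ 2 ∣ m′ n
  step (suc zero)        _   _  _ 2∣1 = <⇒≱ ≤-refl (∣⇒≤ 2∣1)
  step n@(suc (suc n₀)) rec sf _ 2∣m′n = <⇒≱ ≤-refl (∣⇒≤ 2∣1)
    where
    T = ∑[ j < n ∸ 1 ] 𝟙 (2 + j ∣? n)
    term : ∀ j → j < n ∸ 1 → 2 ∣ when (2 + j ∣? n) (m′ (n / (2 + j))) + 𝟙 (2 + j ∣? n)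
    term j _ with 2 + j ∣? n
    ... | no _    = 2 ∣0
    ... | yes d∣n = subst (2 ∣_) (+-comm 1 _)
          (odd⇒2∣1+ (rec (m/n<m n (2 + j) (s≤s (s≤s z≤n)))
                          (λ e 1<e e²∣ → sf e 1<e (∣-trans e²∣ (m/n∣m d∣n)))
                          (m≥n⇒m/n>0 (∣⇒≤ d∣n))))
    2∣m′n+T : 2 ∣ m′ n + T
    2∣m′n+T = subst (2 ∣_) (trans (∑-distrib-+ {f = λ j → when (2 + j ∣? n) (m′ (n / (2 + j)))} (n ∸ 1))
                                  (cong (_+ T) (sym (m′-rec {n} (s≤s (s≤s z≤n))))))
                    (∑-∣ (n ∸ 1) term)
    2∣1+T : 2 ∣ 1 + T
    2∣1+T = subst (2 ∣_) (divisorSum-1+ n (λ _ → 1)) (τ-even sf (s≤s (s≤s z≤n)))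
    2∣1 : 2 ∣ 1
    2∣1 = ∣m+n∣m⇒∣n (subst (2 ∣_) (+-comm 1 T) 2∣1+T) (∣m+n∣m⇒∣n 2∣m′n+T 2∣m′n)

-- Squarefree values of arithmetic progressions

module _ {P : ℕ → Set} (P? : ∀ t → Dec (P t)) where

  count : ℕ → ℕ
  count X = ∑[ t < X ] 𝟙 (P? t)

  module _ (g : ℕ) (sparse : ∀ {t t′} → P t → P t′ → t < t′ → t + g ≤ t′) where

    private
      last-hit : ∀ X → count X ≡ 0 ⊎ ∃[ L ] L < X × P L × count X * g ≤ L + g
      last-hit zero = inj₁ refl
      last-hit (suc X) with P? X | last-hit X
      ... | no _   | inj₁ none              = inj₁ (trans (+-identityʳ _) none)
      ... | no _   | inj₂ (L , L<X , pL , bound) =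
        inj₂ (L , m<n⇒m<1+n L<X , pL , subst (λ c → c * g ≤ L + g) (sym (+-identityʳ (count X))) bound)
      ... | yes pX | inj₁ none = inj₂ (X , ≤-refl , pX , (begin
        (count X + 1) * g   ≡⟨ cong (λ c → (c + 1) * g) none ⟩
        g + 0               ≡⟨ +-identityʳ g ⟩
        g                   ≤⟨ m≤n+m g X ⟩
        X + g               ∎))
        where open ≤-Reasoning
      ... | yes pX | inj₂ (L , L<X , pL , bound) = inj₂ (X , ≤-refl , pX , (begin
        (count X + 1) * g  ≡⟨ *-distribʳ-+ g (count X) 1 ⟩
        count X * g + 1 * g ≤⟨ +-mono-≤ bound (≤-reflexive (*-identityˡ g)) ⟩
        L + g + g          ≤⟨ +-monoˡ-≤ g (sparse pL pX L<X) ⟩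
        X + g              ∎))
        where open ≤-Reasoning

    sparse-count : ∀ X → (count X ∸ 1) * g ≤ X
    sparse-count X with last-hit X
    ... | inj₁ none = subst (λ c → (c ∸ 1) * g ≤ X) (sym none) z≤n
    ... | inj₂ (L , L<X , _ , bound) = begin
      (count X ∸ 1) * g   ≡⟨ *-distribʳ-∸ g (count X) 1 ⟩
      count X * g ∸ 1 * g ≤⟨ ∸-monoˡ-≤ (1 * g) bound ⟩
      L + g ∸ 1 * g       ≡⟨ cong (L + g ∸_) (*-identityˡ g) ⟩
      L + g ∸ g           ≡⟨ m+n∸n≡m L g ⟩
      L                   ≤⟨ <⇒≤ L<X ⟩
      X                   ∎
      where open ≤-Reasoning

-- ∑_{d=3}^{J+2} 1 / (d (d - 1)) = 1/2 - 1/(J + 2), cleared of denominators.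
∑-telescoping-bound : ∀ J X (a : ℕ → ℕ) → (∀ j → j < J → a j * ((3 + j) * (2 + j)) ≤ X) →
                      2 * (2 + J) * ∑< J a ≤ J * X
∑-telescoping-bound zero    X a _     = ≤-reflexive (*-zeroʳ 4)
∑-telescoping-bound (suc J) X a bound = *-cancelˡ-≤ (2 + J) (begin
  (2 + J) * (2 * (3 + J) * (S + a J))                            ≡⟨ regroup J S (a J) ⟩
  (3 + J) * (2 * (2 + J) * S) + 2 * (a J * ((3 + J) * (2 + J)))
    ≤⟨ +-mono-≤ (*-monoʳ-≤ (3 + J) (∑-telescoping-bound J X a (λ j j<J → bound j (m<n⇒m<1+n j<J))))
                (*-monoʳ-≤ 2 (bound J ≤-refl)) ⟩
  (3 + J) * (J * X) + 2 * X                                      ≡⟨ collect J X ⟩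
  (2 + J) * (suc J * X)                                          ∎)
  where
  open ≤-Reasoning
  S = ∑< J a
  regroup : ∀ J S a → (2 + J) * (2 * (3 + J) * (S + a)) ≡ (3 + J) * (2 * (2 + J) * S) + 2 * (a * ((3 + J) * (2 + J)))
  regroup = solve-∀
  collect : ∀ J X → (3 + J) * (J * X) + 2 * X ≡ (2 + J) * (suc J * X)
  collect = solve-∀

module _ {c Q : ℕ} (c⊥Q : Coprime c Q) where

  ∣progression⇒coprime : ∀ {d t} → d ∣ c + Q * t → Coprime d Q
  ∣progression⇒coprime {t = t} d∣c+Qt {e} (e∣d , e∣Q) =
    c⊥Q (∣m+n∣m⇒∣n (subst (e ∣_) (+-comm c (Q * t)) (∣-trans e∣d d∣c+Qt)) (∣-trans e∣Q (m∣m*n t)) , e∣Q)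

  progression-gap : ∀ {d t t′} → d ∣ c + Q * t → d ∣ c + Q * t′ → t < t′ → t + d ≤ t′
  progression-gap {d} {t} {t′} d∣c+Qt d∣c+Qt′ t<t′ = begin
    t + d       ≤⟨ +-monoʳ-≤ t (∣⇒≤ {{>-nonZero (m<n⇒0<n∸m t<t′)}} d∣k) ⟩
    t + k       ≡⟨ m+[n∸m]≡n (<⇒≤ t<t′) ⟩
    t′          ∎
    where
    open ≤-Reasoning
    k = t′ ∸ t
    shift : ∀ c Q t k → c + Q * (t + k) ≡ (c + Q * t) + Q * k
    shift = solve-∀
    c+Qt′≡c+Qt+Qk : c + Q * t′ ≡ c + Q * t + Q * k
    c+Qt′≡c+Qt+Qk = trans (cong (λ s → c + Q * s) (sym (m+[n∸m]≡n (<⇒≤ t<t′)))) (shift c Q t k)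
    d∣k : d ∣ k
    d∣k = coprime-divisor (∣progression⇒coprime d∣c+Qt) (∣m+n∣m⇒∣n (subst (d ∣_) c+Qt′≡c+Qt+Qk d∣c+Qt′) d∣c+Qt)

  -- The multiples of (3 + j)² have density at most 1 / ((3 + j)(2 + j)), and 4 never divides c + Q t
  -- because Q is even and c is odd.
  ∃avoiding-small-squares : ∀ X J → 2 ∣ Q → 2 * J < X →
                            ∃[ t ] t < X × ∑[ j < suc J ] 𝟙 ((2 + j) * (2 + j) ∣? c + Q * t) ≡ 0
  ∃avoiding-small-squares X J 2∣Q 2J<X = ∑<-pigeonhole X h ∑h<X
    where
    hits : ℕ → ℕ
    hits d = count (λ t → d * d ∣? c + Q * t) X
    h : ℕ → ℕ
    h t = ∑[ j < suc J ] 𝟙 ((2 + j) * (2 + j) ∣? c + Q * t)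
    no-4 : ∀ t → t < X → 𝟙 (2 * 2 ∣? c + Q * t) ≡ 0
    no-4 t _ with 2 * 2 ∣? c + Q * t
    ... | no _   = refl
    ... | yes 4∣ = contradiction (∣progression⇒coprime 4∣ (m∣m*n 2 , 2∣Q)) λ ()
    excess : ℕ → ℕ
    excess j = hits (3 + j) ∸ 1
    excess-bound : ∀ j → j < J → excess j * ((3 + j) * (2 + j)) ≤ X
    excess-bound j _ = ≤-trans (*-monoʳ-≤ (excess j) (*-monoʳ-≤ (3 + j) (n≤1+n (2 + j))))
                               (sparse-count _ ((3 + j) * (3 + j)) progression-gap X)
    2∑excess≤X : 2 * ∑< J excess ≤ X
    2∑excess≤X = *-cancelˡ-≤ (2 + J) (begin
      (2 + J) * (2 * ∑< J excess) ≡⟨ sym (*-assoc (2 + J) 2 (∑< J excess)) ⟩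
      (2 + J) * 2 * ∑< J excess   ≡⟨ cong (_* ∑< J excess) (*-comm (2 + J) 2) ⟩
      2 * (2 + J) * ∑< J excess   ≤⟨ ∑-telescoping-bound J X excess excess-bound ⟩
      J * X                       ≤⟨ *-monoˡ-≤ X (m≤n+m J 2) ⟩
      (2 + J) * X                 ∎)
      where open ≤-Reasoning
    ∑h<X : ∑< X h < X
    ∑h<X = *-cancelˡ-< 2 (∑< X h) X (begin-strict
      2 * ∑< X h                                 ≡⟨ cong (2 *_) (∑-swap X (suc J) _) ⟩
      2 * ∑[ j < suc J ] hits (2 + j)             ≡⟨ cong (2 *_) (∑-shift J (λ j → hits (2 + j))) ⟩
      2 * (hits 2 + ∑[ j < J ] hits (3 + j))      ≡⟨ cong (λ z → 2 * (z + ∑[ j < J ] hits (3 + j))) (∑-zero X no-4) ⟩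
      2 * ∑[ j < J ] hits (3 + j)
        ≤⟨ *-monoʳ-≤ 2 (∑-mono-≤ J (λ j _ → m≤n+m∸n (hits (3 + j)) 1)) ⟩
      2 * ∑[ j < J ] (1 + excess j)
        ≡⟨ cong (2 *_) (trans (∑-distrib-+ J) (cong (_+ ∑< J excess) (trans (∑-const J 1) (*-identityʳ J)))) ⟩
      2 * (J + ∑< J excess)                       ≡⟨ *-distribˡ-+ 2 J _ ⟩
      2 * J + 2 * ∑< J excess                     <⟨ +-mono-<-≤ 2J<X 2∑excess≤X ⟩
      X + X                                       ≡⟨ cong (X +_) (sym (+-identityʳ X)) ⟩
      2 * X                                       ∎)
      where open ≤-Reasoning

  ∃squareFree-below : ∀ X J → 2 ∣ Q → 2 * J < X →
                      (∀ t → t < X → ∀ d → 3 + J ≤ d → ¬ d * d ∣ c + Q * t) →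
                      ∃[ t ] SquareFree (c + Q * t)
  ∃squareFree-below X J 2∣Q 2J<X large with ∃avoiding-small-squares X J 2∣Q 2J<X
  ... | t , t<X , ht≡0 = t , squareFree
    where
    squareFree : SquareFree (c + Q * t)
    squareFree d 1<d d²∣ with 3 + J ≤? d
    ... | yes 3+J≤d = large t t<X d 3+J≤d d²∣
    ... | no 3+J≰d  =
      <⇒≱ 0<term (≤-trans (term≤∑ (suc J) _ (∸-monoˡ-< {n = 2} (≰⇒> 3+J≰d) 1<d)) (≤-reflexive ht≡0))
      where
      0<term : 0 < 𝟙 ((2 + (d ∸ 2)) * (2 + (d ∸ 2)) ∣? c + Q * t)
      0<term with (2 + (d ∸ 2)) * (2 + (d ∸ 2)) ∣? c + Q * t
      ... | yes _ = z<s
      ... | no ∤  = ⊥-elim (∤ (subst (λ e → e * e ∣ c + Q * t) (sym (m+[n∸m]≡n 1<d)) d²∣))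

∃squareFree-progression : ∀ {c Q} → 2 ∣ Q → Coprime c Q → ∃[ t ] SquareFree (c + Q * t)
∃squareFree-progression {zero}      2∣Q 0⊥Q = contradiction (0⊥Q ((2 ∣0) , 2∣Q)) λ ()
∃squareFree-progression {c@(suc _)} {Q} 2∣Q c⊥Q = ∃squareFree-below c⊥Q X J 2∣Q 2J<X large
  where
  K = c + Q
  X = 16 * K
  J = 4 * K
  X≡2J+8K : ∀ K → 16 * K ≡ 2 * (4 * K) + 8 * K
  X≡2J+8K = solve-∀
  [3+J]²≡K*X+_ : ∀ K → (3 + 4 * K) * (3 + 4 * K) ≡ K * (16 * K) + (9 + 24 * K)
  [3+J]²≡K*X+_ = solve-∀
  2J<X : 2 * J < X
  2J<X = subst (2 * J <_) (sym (X≡2J+8K K)) (m<m+n (2 * J) z<s)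
  c+Qt≤K*X : ∀ t → t < X → c + Q * t ≤ K * X
  c+Qt≤K*X t t<X = ≤-trans (+-mono-≤ (m≤m*n c X) (*-monoʳ-≤ Q (<⇒≤ t<X))) (≤-reflexive (sym (*-distribʳ-+ X c Q)))
  large : ∀ t → t < X → ∀ d → 3 + J ≤ d → ¬ d * d ∣ c + Q * t
  large t t<X d 3+J≤d d²∣ = <⇒≱ (subst (K * X <_) (sym ([3+J]²≡K*X+_ K)) (m<m+n (K * X) z<s))
                                 (≤-trans (*-mono-≤ 3+J≤d 3+J≤d) (≤-trans (∣⇒≤ d²∣) (c+Qt≤K*X t t<X)))

-- Choosing n by the Chinese remainder theorem

m≤n⇒m∣n! : ∀ {m n} → 0 < m → m ≤ n → m ∣ n !
m≤n⇒m∣n! {suc m} _ m≤n = ∣-trans (m∣m*n (m !)) (m≤n⇒m!∣n! m≤n)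

∃prime-avoiding : ∀ k M .{{_ : NonZero M}} → ∃[ p ] Prime p × k < p × ¬ p ∣ M
∃prime-avoiding k M {{M≢0}}
  with ∃prime∣ {suc (M * k !)} (s<s (>-nonZero⁻¹ (M * k !) {{m*n≢0 M (k !) {{M≢0}} {{k !≢0}}}}))
... | p , pp , p∣1+M*k! = p , pp , k<p , p∤M
  where
  p∤M*k! : ¬ p ∣ M * k !
  p∤M*k! p∣M*k! = <⇒≱ (prime⇒>1 pp) (∣⇒≤ (∣m+n∣m⇒∣n (subst (p ∣_) (+-comm 1 (M * k !)) p∣1+M*k!) p∣M*k!))
  p∤M : ¬ p ∣ M
  p∤M p∣M = p∤M*k! (∣m⇒∣m*n (k !) p∣M)
  k<p : k < p
  k<p with k <? p
  ... | yes k<p = k<p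
  ... | no k≮p  = ⊥-elim (p∤M*k! (∣n⇒∣m*n M (m≤n⇒m∣n! (<-trans z<s (prime⇒>1 pp)) (≮⇒≥ k≮p))))

∃linear-solution : ∀ {M P} a .{{_ : NonZero P}} → Coprime M P → ∃[ t ] P ∣ a + M * t
∃linear-solution {M} {P@(suc P′)} a M⊥P with coprime-Bézout M⊥P
... | Bézout.+- x y 1+yP≡xM = x * a * P′ , divides (a + y * a * P′) (begin
  a + M * (x * a * P′)         ≡⟨ regroup a M x P′ ⟩
  a + (x * M) * (a * P′)       ≡⟨ cong (λ z → a + z * (a * P′)) (sym 1+yP≡xM) ⟩
  a + (1 + y * P) * (a * P′)   ≡⟨ factor a y P′ ⟩
  (a + y * a * P′) * P         ∎)
  where
  open ≡-Reasoning
  regroup : ∀ a M x P′ → a + M * (x * a * P′) ≡ a + (x * M) * (a * P′)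
  regroup = solve-∀
  factor : ∀ a y P′ → a + (1 + y * suc P′) * (a * P′) ≡ (a + y * a * P′) * suc P′
  factor = solve-∀
... | Bézout.-+ x y 1+xM≡yP = x * a , divides (a * y) (begin
  a + M * (x * a)   ≡⟨ factor a M x ⟩
  a * (1 + x * M)   ≡⟨ cong (a *_) 1+xM≡yP ⟩
  a * (y * P)       ≡⟨ *-assoc a y P ⟨
  a * y * P         ∎)
  where
  open ≡-Reasoning
  factor : ∀ a M x → a + M * (x * a) ≡ a * (1 + x * M)
  factor = solve-∀

∣-shift-gap : ∀ {p a i i′} → p ∣ a + i → p ∣ a + i′ → i < i′ → p ≤ i′ ∸ i
∣-shift-gap {p} {a} {i} {i′} p∣a+i p∣a+i′ i<i′ = ∣⇒≤ {{>-nonZero (m<n⇒0<n∸m i<i′)}}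
  (∣m+n∣m⇒∣n (subst (p ∣_) a+i′≡a+i+[i′∸i] p∣a+i′) p∣a+i)
  where
  a+i′≡a+i+[i′∸i] : a + i′ ≡ a + i + (i′ ∸ i)
  a+i′≡a+i+[i′∸i] = trans (cong (a +_) (sym (m+[n∸m]≡n (<⇒≤ i<i′)))) (sym (+-assoc a i _))

∣-shifts⇒≡ : ∀ {p a i i′ k} → p ∣ a + i → p ∣ a + i′ → i ≤ k → i′ ≤ k → k < p → i ≡ i′
∣-shifts⇒≡ {i = i} {i′} p∣a+i p∣a+i′ i≤k i′≤k k<p with <-cmp i i′
... | tri≈ _ i≡i′ _ = i≡i′
... | tri< i<i′ _ _ = ⊥-elim (<⇒≱ k<p (≤-trans (∣-shift-gap p∣a+i p∣a+i′ i<i′) (≤-trans (m∸n≤m i′ i) i′≤k)))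
... | tri> _ _ i′<i = ⊥-elim (<⇒≱ k<p (≤-trans (∣-shift-gap p∣a+i′ p∣a+i i′<i) (≤-trans (m∸n≤m i i′) i≤k)))

module Window {k j : ℕ} (s x₀ : ℕ) (j≤k : j ≤ k) where

  -- The conditions imposed on the shifts n + i with i < B; all of them survive n ↦ n + M * t.
  record Stage (B : ℕ) : Set where
    field
      n M          : ℕ
      M≢0          : NonZero M
      2^s∣M        : 2 ^ s ∣ M
      n≡x₀         : ∃[ u ] n ≡ x₀ + 2 ^ s * u
      n+j⊥M        : Coprime (n + j) M
      prime-powers : ∀ i → i < B → i ≢ j → ∃[ p ] Prime p × p ^ suc s ∣ M × p ^ suc s ∣ n + i

  open Stage

  shift : ∀ {B} → Stage B → ℕ → Stage B
  shift σ t = record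
    { n            = n σ + M σ * t
    ; M            = M σ
    ; M≢0          = M≢0 σ
    ; 2^s∣M        = 2^s∣M σ
    ; n≡x₀         = n′≡x₀ (n≡x₀ σ) (2^s∣M σ)
    ; n+j⊥M        = subst (λ a → Coprime a (M σ)) (sym (reorder (n σ) (M σ * t) j)) (coprime-+* t (n+j⊥M σ))
    ; prime-powers = λ i i<B i≢j → let p , pp , P∣M , P∣n+i = prime-powers σ i i<B i≢j in
        p , pp , P∣M , subst (p ^ suc s ∣_) (sym (reorder (n σ) (M σ * t) i))
                             (∣m∣n⇒∣m+n P∣n+i (∣-trans P∣M (m∣m*n t)))
    }
    where
    reorder : ∀ n Mt i → n + Mt + i ≡ n + i + Mt
    reorder = solve-∀
    n′≡x₀ : ∃[ u ] n σ ≡ x₀ + 2 ^ s * u → 2 ^ s ∣ M σ → ∃[ u ] n σ + M σ * t ≡ x₀ + 2 ^ s * u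
    n′≡x₀ (u , n≡) (divides w M≡) = u + w * t , (begin
      n σ + M σ * t                 ≡⟨ cong₂ (λ a b → a + b * t) n≡ M≡ ⟩
      x₀ + 2 ^ s * u + w * 2 ^ s * t ≡⟨ collect x₀ (2 ^ s) u w t ⟩
      x₀ + 2 ^ s * (u + w * t)       ∎)
      where
      open ≡-Reasoning
      collect : ∀ x P u w t → x + P * u + w * P * t ≡ x + P * (u + w * t)
      collect = solve-∀

  -- p ^ suc s is coprime to M, so the Chinese remainder theorem adds the condition p ^ suc s ∣ n + B;
  -- and p ∤ n + j because 0 < |B - j| ≤ k < p.
  extend-by : ∀ {B p} (σ : Stage B) → B ≤ k → B ≢ j → Prime p → k < p → ¬ p ∣ M σ → Stage (suc B)
  extend-by {B} {p} σ B≤k B≢j pp k<p p∤M = record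
    { n            = n σ′
    ; M            = M σ′ * P
    ; M≢0          = m*n≢0 (M σ′) P {{M≢0 σ′}}
    ; 2^s∣M        = ∣m⇒∣m*n P (2^s∣M σ′)
    ; n≡x₀         = n≡x₀ σ′
    ; n+j⊥M        = coprime-*ʳ (n+j⊥M σ′) (Coprimality.sym (prime^-coprime pp p∤n′+j (suc s)))
    ; prime-powers = powers
    }
    where
    P = p ^ suc s
    instance
      P≢0 : NonZero P
      P≢0 = m^n≢0 p (suc s) {{prime⇒nonZero pp}}
    solution = ∃linear-solution (n σ + B) (Coprimality.sym (prime^-coprime pp p∤M (suc s)))
    σ′ = shift σ (proj₁ solution)
    reorder : ∀ n B Mt → n + B + Mt ≡ n + Mt + B
    reorder = solve-∀
    P∣n′+B : P ∣ n σ′ + B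
    P∣n′+B = subst (P ∣_) (reorder (n σ) B _) (proj₂ solution)
    p∤n′+j : ¬ p ∣ n σ′ + j
    p∤n′+j p∣n′+j = B≢j (∣-shifts⇒≡ (m*n∣⇒m∣ p (p ^ s) P∣n′+B) p∣n′+j B≤k j≤k k<p)
    powers : ∀ i → i < suc B → i ≢ j → ∃[ q ] Prime q × q ^ suc s ∣ M σ′ * P × q ^ suc s ∣ n σ′ + i
    powers i i<1+B i≢j with m<1+n⇒m<n∨m≡n i<1+B
    ... | inj₁ i<B = let q , pq , Q∣M , Q∣n′+i = prime-powers σ′ i i<B i≢j in q , pq , ∣m⇒∣m*n P Q∣M , Q∣n′+i
    ... | inj₂ refl = p , pp , n∣m*n (M σ′) , P∣n′+B

  extend : ∀ {B} → Stage B → B ≤ k → B ≢ j → Stage (suc B)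
  extend σ B≤k B≢j with ∃prime-avoiding k (M σ) {{M≢0 σ}}
  ... | p , pp , k<p , p∤M = extend-by σ B≤k B≢j pp k<p p∤M

  skip : ∀ {B} → Stage B → B ≡ j → Stage (suc B)
  skip {B} σ B≡j = record
    { n = n σ ; M = M σ ; M≢0 = M≢0 σ ; 2^s∣M = 2^s∣M σ ; n≡x₀ = n≡x₀ σ ; n+j⊥M = n+j⊥M σ
    ; prime-powers = powers
    }
    where
    powers : ∀ i → i < suc B → i ≢ j → ∃[ q ] Prime q × q ^ suc s ∣ M σ × q ^ suc s ∣ n σ + i
    powers i i<1+B i≢j with m<1+n⇒m<n∨m≡n i<1+B
    ... | inj₁ i<B  = prime-powers σ i i<B i≢j
    ... | inj₂ refl = ⊥-elim (i≢j B≡j)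

  initial : ¬ 2 ∣ x₀ + j → Stage 0
  initial 2∤x₀+j = record
    { n            = x₀
    ; M            = 2 ^ s
    ; M≢0          = m^n≢0 2 s
    ; 2^s∣M        = ∣-refl
    ; n≡x₀         = 0 , sym (trans (cong (x₀ +_) (*-zeroʳ (2 ^ s))) (+-identityʳ x₀))
    ; n+j⊥M        = Coprimality.sym (prime^-coprime prime[2] 2∤x₀+j s)
    ; prime-powers = λ _ ()
    }

  stage : ¬ 2 ∣ x₀ + j → ∀ B → B ≤ suc k → Stage B
  stage 2∤x₀+j zero    _      = initial 2∤x₀+j
  stage 2∤x₀+j (suc B) 1+B≤1+k with B ≟ j
  ... | yes B≡j = skip (stage 2∤x₀+j B (<⇒≤ 1+B≤1+k)) B≡j
  ... | no B≢j  = extend (stage 2∤x₀+j B (<⇒≤ 1+B≤1+k)) (≤-pred 1+B≤1+k) B≢j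

∃window : ∀ {k j} s x₀ → j ≤ k → 0 < s → ¬ 2 ∣ x₀ + j →
          ∃[ n ] (∃[ u ] n ≡ x₀ + 2 ^ s * u) × SquareFree (n + j) ×
                 (∀ i → i ≤ k → i ≢ j → ∃[ p ] Prime p × p ^ suc s ∣ n + i)
∃window {k} {j} s@(suc s′) x₀ j≤k _ 2∤x₀+j = n σ′ , n≡x₀ σ′ , squareFree , powers
  where
  open Window s x₀ j≤k
  open Stage
  σ = stage 2∤x₀+j (suc k) ≤-refl
  2∣M : 2 ∣ M σ
  2∣M = ∣-trans (m∣m*n (2 ^ s′)) (2^s∣M σ)
  solution = ∃squareFree-progression 2∣M (n+j⊥M σ)
  σ′ = shift σ (proj₁ solution)
  reorder : ∀ n j Mt → n + j + Mt ≡ n + Mt + j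
  reorder = solve-∀
  squareFree : SquareFree (n σ′ + j)
  squareFree = subst SquareFree (reorder (n σ) j _) (proj₂ solution)
  powers : ∀ i → i ≤ k → i ≢ j → ∃[ p ] Prime p × p ^ suc s ∣ n σ′ + i
  powers i i≤k i≢j = let p , pp , _ , P∣n′+i = prime-powers σ′ i (s≤s i≤k) i≢j in p , pp , P∣n′+i

open import Data.Integer using (+_; ∣_∣)

∣0ℤ : ∀ {d} → d ℤ∣.∣ + 0
∣0ℤ {d} = ∣ᵤ⇒∣ (∣ d ∣ ∣0)

eval-shift-∣ : ∀ f x M u → (+ M) ℤ∣.∣ eval f (x + M * u) ℤ.- eval f x
eval-shift-∣ []       x M u = ∣0ℤ
eval-shift-∣ (c ∷ cs) x M u = subst ((+ M) ℤ∣.∣_) (sym difference)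
  (ℤ∣.∣m∣n⇒∣m+n (ℤ∣.∣n⇒∣m*n (+ x) (eval-shift-∣ cs x M u)) (ℤ∣.∣m⇒∣m*n _ ℤ∣.∣-refl))
  where
  open ≡-Reasoning
  E′ = eval cs (x + M * u)
  E  = eval cs x
  expand : ∀ c X M U E′ E →
           (c ℤ.+ (X ℤ.+ M ℤ.* U) ℤ.* E′) ℤ.- (c ℤ.+ X ℤ.* E) ≡ X ℤ.* (E′ ℤ.- E) ℤ.+ M ℤ.* (U ℤ.* E′)
  expand = solve-ℤ
  difference : eval (c ∷ cs) (x + M * u) ℤ.- eval (c ∷ cs) x ≡ (+ x) ℤ.* (E′ ℤ.- E) ℤ.+ (+ M) ℤ.* ((+ u) ℤ.* E′)
  difference = begin
    (c ℤ.+ + (x + M * u) ℤ.* E′) ℤ.- (c ℤ.+ + x ℤ.* E)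
      ≡⟨ cong (λ y → (c ℤ.+ y ℤ.* E′) ℤ.- (c ℤ.+ + x ℤ.* E))
              (trans (ℤ.pos-+ x (M * u)) (cong (λ y → + x ℤ.+ y) (ℤ.pos-* M u))) ⟩
    (c ℤ.+ (+ x ℤ.+ + M ℤ.* + u) ℤ.* E′) ℤ.- (c ℤ.+ + x ℤ.* E)
      ≡⟨ expand c (+ x) (+ M) (+ u) E′ E ⟩
    (+ x) ℤ.* (E′ ℤ.- E) ℤ.+ (+ M) ℤ.* ((+ u) ℤ.* E′)
      ∎

-- A nonzero constant term would be divisible by arbitrarily large points x.
vanishing⇒IsZeroPoly : ∀ f → (∀ t → ∃[ x ] t < x × eval f x ≡ + 0) → IsZeroPoly f
vanishing⇒IsZeroPoly []       _      = tt
vanishing⇒IsZeroPoly (c ∷ cs) roots = c≡0 , vanishing⇒IsZeroPoly cs roots′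
  where
  x∣c : ∀ {x} → c ℤ.+ + x ℤ.* eval cs x ≡ + 0 → (+ x) ℤ∣.∣ c
  x∣c {x} eq = ℤ∣.∣m+n∣n⇒∣m (subst ((+ x) ℤ∣.∣_) (sym eq) ∣0ℤ) (ℤ∣.∣m⇒∣m*n _ ℤ∣.∣-refl)
  c≡0 : c ≡ + 0
  c≡0 with roots ∣ c ∣
  ... | x , ∣c∣<x , root with ∣ c ∣ ≟ 0
  ...   | yes ∣c∣≡0 = ℤ.∣i∣≡0⇒i≡0 ∣c∣≡0
  ...   | no ∣c∣≢0  = ⊥-elim (<⇒≱ ∣c∣<x (∣⇒≤ {{≢-nonZero ∣c∣≢0}} (∣⇒∣ᵤ (x∣c root))))
  roots′ : ∀ t → ∃[ x ] t < x × eval cs x ≡ + 0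
  roots′ t with roots t
  ... | x , t<x , root
    with ℤ.i*j≡0⇒i≡0∨j≡0 (+ x) (trans (sym (ℤ.+-identityˡ _)) (trans (cong (ℤ._+ _) (sym c≡0)) root))
  ...   | inj₁ x≡0 = ⊥-elim (<⇒≢ (≤-<-trans z≤n t<x) (sym (ℤ.+-injective x≡0)))
  ...   | inj₂ E≡0 = x , t<x , E≡0

module _ {D : ℤ} where

  ∣∑ : ∀ {n} (t : Fin n → ℤ) → (∀ i → D ℤ∣.∣ t i) → D ℤ∣.∣ foldr ℤ._+_ (+ 0) (tabulate t)
  ∣∑ {zero}  t D∣t = ∣0ℤ
  ∣∑ {suc n} t D∣t = ℤ∣.∣m∣n⇒∣m+n (D∣t Fin.zero) (∣∑ (t ∘ Fin.suc) (D∣t ∘ Fin.suc))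

  ∣∑-others⇒∣ : ∀ {n} (t : Fin n → ℤ) j → D ℤ∣.∣ foldr ℤ._+_ (+ 0) (tabulate t) →
                (∀ i → i ≢ j → D ℤ∣.∣ t i) → D ℤ∣.∣ t j
  ∣∑-others⇒∣ t Fin.zero    D∣∑ D∣others =
    ℤ∣.∣m+n∣n⇒∣m D∣∑ (∣∑ (t ∘ Fin.suc) (λ i → D∣others (Fin.suc i) λ ()))
  ∣∑-others⇒∣ t (Fin.suc j) D∣∑ D∣others =
    ∣∑-others⇒∣ (t ∘ Fin.suc) j (ℤ∣.∣m+n∣m⇒∣n D∣∑ (D∣others Fin.zero λ ()))
                (λ i i≢j → D∣others (Fin.suc i) (i≢j ∘ Fin.suc-injective))

n<2^n : ∀ n → n < 2 ^ n
n<2^n zero    = z<s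
n<2^n (suc n) = subst (_≤ 2 ^ suc n) (+-comm (suc n) 1) (+-mono-≤ (n<2^n n) (≤-trans (m^n>0 2 n) (m≤m+n (2 ^ n) 0)))

2^∣i∣∣i⇒i≡0 : ∀ {i} → + (2 ^ ∣ i ∣) ℤ∣.∣ i → i ≡ + 0
2^∣i∣∣i⇒i≡0 {i} 2^∣i∣∣i with ∣ i ∣ ≟ 0
... | yes ∣i∣≡0 = ℤ.∣i∣≡0⇒i≡0 ∣i∣≡0
... | no ∣i∣≢0  = ⊥-elim (<⇒≱ (n<2^n ∣ i ∣) (∣⇒≤ {{≢-nonZero ∣i∣≢0}} (∣⇒∣ᵤ 2^∣i∣∣i)))

module Recurrence (k : ℕ) (g : Fin (suc k) → Poly)
  (rec : ∀ n → 1 ≤ n → sumFin k (λ i → eval (g i) n ℤ.* + m (n + toℕ i)) ≡ + 0) where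

  2^s∣eval : ∀ j s x₀ → 1 < x₀ → ¬ 2 ∣ x₀ + toℕ j → + (2 ^ s) ℤ∣.∣ eval (g j) x₀
  2^s∣eval j zero      x₀ _    _  = ∣ᵤ⇒∣ (1∣ _)
  2^s∣eval j s@(suc _) x₀ 1<x₀ 2∤ with ∃window s x₀ (≤-pred (Fin.toℕ<n j)) z<s 2∤
  ... | n , (u , n≡x₀+2^su) , squareFree , powers =
    subst (D ℤ∣.∣_) (cancel (eval (g j) n) _) (ℤ∣.∣m∣n⇒∣m-n D∣g[n] D∣g[n]-g[x₀])
    where
    D = + (2 ^ s)
    cancel : ∀ a b → a ℤ.- (a ℤ.- b) ≡ b
    cancel = solve-ℤ
    1<n : 1 < n
    1<n = ≤-trans 1<x₀ (≤-trans (m≤m+n x₀ _) (≤-reflexive (sym n≡x₀+2^su)))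
    1<n+ : ∀ i → 1 < n + i
    1<n+ i = ≤-trans 1<n (m≤m+n n i)
    term : Fin (suc k) → ℤ
    term i = eval (g i) n ℤ.* + m (n + toℕ i)
    D∣others : ∀ i → i ≢ j → D ℤ∣.∣ term i
    D∣others i i≢j with powers (toℕ i) (≤-pred (Fin.toℕ<n i)) (i≢j ∘ Fin.toℕ-injective)
    ... | p , pp , P∣n+i = ℤ∣.∣n⇒∣m*n (eval (g i) n)
          (∣ᵤ⇒∣ (subst (2 ^ s ∣_) (sym (m≡m′ (1<n+ (toℕ i)))) (prime^∣⇒2^∣m′ pp s _ P∣n+i)))
    D∣term : D ℤ∣.∣ term j
    D∣term = ∣∑-others⇒∣ term j (subst (D ℤ∣.∣_) (sym (rec n (<⇒≤ 1<n))) ∣0ℤ) D∣others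
    D∣g[n] : D ℤ∣.∣ eval (g j) n
    D∣g[n] = ∣ᵤ⇒∣ (coprime-divisor (prime^-coprime prime[2] m[n+j]-odd s)
                     (subst (2 ^ s ∣_) (trans (ℤ.abs-* (eval (g j) n) _) (*-comm _ (m (n + toℕ j)))) (∣⇒∣ᵤ D∣term)))
      where
      m[n+j]-odd : ¬ 2 ∣ m (n + toℕ j)
      m[n+j]-odd = subst (λ c → ¬ 2 ∣ c) (sym (m≡m′ (1<n+ (toℕ j))))
                         (squareFree⇒m′-odd squareFree (<-trans z<s (1<n+ (toℕ j))))
    D∣g[n]-g[x₀] : D ℤ∣.∣ eval (g j) n ℤ.- eval (g j) x₀
    D∣g[n]-g[x₀] = subst (λ y → D ℤ∣.∣ eval (g j) y ℤ.- eval (g j) x₀) (sym n≡x₀+2^su)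
                         (eval-shift-∣ (g j) x₀ (2 ^ s) u)

  vanishes : ∀ j x₀ → 1 < x₀ → ¬ 2 ∣ x₀ + toℕ j → eval (g j) x₀ ≡ + 0
  vanishes j x₀ 1<x₀ 2∤ = 2^∣i∣∣i⇒i≡0 (2^s∣eval j ∣ eval (g j) x₀ ∣ x₀ 1<x₀ 2∤)

  isZeroPoly : ∀ j → IsZeroPoly (g j)
  isZeroPoly j = vanishing⇒IsZeroPoly (g j) λ t → x₀ t , t<x₀ t , vanishes j (x₀ t) (s≤s (s≤s z≤n)) (2∤x₀+j t)
    where
    x₀ : ℕ → ℕ
    x₀ t = 3 + 2 * t + toℕ j
    t<x₀ : ∀ t → t < x₀ t
    t<x₀ t = subst (t <_) (sym (regroup t (toℕ j))) (m≤m+n (suc t) (2 + t + toℕ j))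
      where
      regroup : ∀ t j → 3 + 2 * t + j ≡ suc t + (2 + t + j)
      regroup = solve-∀
    2∤x₀+j : ∀ t → ¬ 2 ∣ x₀ t + toℕ j
    2∤x₀+j t 2∣ =
      <⇒≱ (n<1+n 1) (∣⇒≤ (∣m+n∣m⇒∣n (subst (2 ∣_) (regroup t (toℕ j)) 2∣) (m∣m*n (1 + t + toℕ j))))
      where
      regroup : ∀ t j → 3 + 2 * t + j + j ≡ 2 * (1 + t + j) + 1
      regroup = solve-∀

proposition15 : ¬ Holonomic (λ n → + (m n))
proposition15 (k , g , nonzero , rec) = nonzero (Recurrence.isZeroPoly k g rec)
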